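{- Let $n\in\mathbb{Z}^+$ with $n\geq 2$. Let $R_3$, $R_4$, $R_6$ denote the (infinite) graphs of the regular tilings of the plane by triangles, squares, and hexagons, respectively. Then $\chi_{n} (R_3) = 3$, $\chi_{n} (R_4) = 2$, and $\chi_{n} (R_6) = 2$.
   Context: The graph of a tiling has the tile corners as vertices and tile edges as edges (so $R_3$ is 6-regular, $R_4$ is 4-regular, $R_6$ is 3-regular). For a graph $G=(V,E)$, a $\mathbb{Z}$-labeling is a map $\ell:V\to\mathbb{Z}$; its order is the size of its range; it is proper if adjacent vertices get different labels. $N[v]$ is the closed neighborhood of $v$. A closed coloring with nonzero remainders mod $n$ is a labeling with $\sum_{w\in N[v]}\ell(w)\not\equiv 0 \pmod n$ for all $v\in V$. $\chi_n(G)$ denotes the minimum order of a proper closed coloring with nonzero remainders mod $n$ of $G$. -}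

module Defs where

open import Data.Nat using (ℕ; _≤_)
open import Data.Integer as ℤ using (ℤ; +_; _+_; _-_; 1ℤ)
open import Data.Integer.Divisibility using (_∣_)
open import Data.Bool using (Bool; true; false)
open import Data.Fin using (Fin)
open import Data.List using (List; []; _∷_; map; foldr)
open import Data.List.Membership.Propositional using (_∈_)
open import Data.Product using (Σ; ∃; _×_; _,_)
open import Relation.Nullary using (¬_)
open import Relation.Binary.PropositionalEquality using (_≡_; _≢_)
open import Function.Definitions using (Injective)

record Graph : Set₁ where
  field
    V    : Set
    nbrs : V → List V
open Graph public

Labeling : Graph → Set
Labeling G = V G → ℤ

sumℤ : List ℤ → ℤ
sumℤ = foldr _+_ (+ 0)

closedSum : (G : Graph) → Labeling G → V G → ℤ
closedSum G ℓ v = ℓ v + sumℤ (map ℓ (nbrs G v))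

Proper : (G : Graph) → Labeling G → Set
Proper G ℓ = ∀ v w → w ∈ nbrs G v → ℓ v ≢ ℓ w

ClosedNonzeroMod : ℕ → (G : Graph) → Labeling G → Set
ClosedNonzeroMod n G ℓ = ∀ v → ¬ ((+ n) ∣ closedSum G ℓ v)

HasOrder : (G : Graph) → Labeling G → ℕ → Set
HasOrder G ℓ k = Σ (Fin k → ℤ) λ r →
  Injective _≡_ _≡_ r × (∀ v → ∃ λ i → ℓ v ≡ r i) × (∀ i → ∃ λ v → ℓ v ≡ r i)

Good : ℕ → (G : Graph) → Labeling G → Set
Good n G ℓ = Proper G ℓ × ClosedNonzeroMod n G ℓ

-- χ_n(G) = k : some proper closed coloring with nonzero remainders mod n has
-- order k, and every such coloring of finite order m has k ≤ m
-- (colorings of infinite order trivially have order ≥ k).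
ChiIs : ℕ → Graph → ℕ → Set
ChiIs n G k =
  (∃ λ (ℓ : Labeling G) → Good n G ℓ × HasOrder G ℓ k)
  × (∀ (ℓ : Labeling G) → Good n G ℓ → ∀ m → HasOrder G ℓ m → k ≤ m)

inc dec : ℤ → ℤ
inc a = a + 1ℤ
dec a = a - 1ℤ

R₄ : Graph
R₄ = record { V = ℤ × ℤ ; nbrs = λ { (a , b) →
  (inc a , b) ∷ (dec a , b) ∷ (a , inc b) ∷ (a , dec b) ∷ [] } }

-- triangular tiling R₃ (square lattice plus one diagonal per square):
-- (a,b) ~ (a±1,b), (a,b±1), (a+1,b-1), (a-1,b+1)
R₃ : Graph
R₃ = record { V = ℤ × ℤ ; nbrs = λ { (a , b) →
  (inc a , b) ∷ (dec a , b) ∷ (a , inc b) ∷ (a , dec b)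
  ∷ (inc a , dec b) ∷ (dec a , inc b) ∷ [] } }

-- hexagonal tiling R₆ (honeycomb) as a bipartite graph on ℤ × ℤ × Bool:
-- (a,b,false) ~ (a,b,true), (a-1,b,true), (a,b-1,true)
-- (a,b,true)  ~ (a,b,false), (a+1,b,false), (a,b+1,false)
R₆ : Graph
R₆ = record { V = ℤ × ℤ × Bool ; nbrs = λ
  { (a , b , false) → (a , b , true) ∷ (dec a , b , true) ∷ (a , dec b , true) ∷ []
  ; (a , b , true)  → (a , b , false) ∷ (inc a , b , false) ∷ (a , inc b , false) ∷ [] } }

-- A proper labelling is injective on a clique, so a triangle of R₃ and an edge of
-- R₄ or R₆ bound the order from below. For the upper bound colour R₃ by
-- (a − b) mod 3, R₄ by (a − b) mod 2 and R₆ by its bipartition. In each colouring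
-- the colours around a vertex depend only on its own colour, so for a labelling
-- of the colours the closed sum at a vertex is one of finitely many integers.
-- Labels making these sums ±1 or a prime p work for every n ≠ p, and for n = p
-- other labels are checked directly.
module Submission where

open import Defs
open import Data.Nat using (ℕ; _≤_; zero; suc)
import Data.Nat.Properties as ℕ
import Data.Nat.Divisibility as ℕ
open import Data.Nat.GeneralisedArithmetic using (fold)
open import Data.Nat.Primality using (Prime; prime?; prime⇒irreducible)
open import Data.Integer as ℤ using (ℤ; +_; -[1+_]; _+_; _-_; 1ℤ)
open import Data.Integer.Divisibility using (_∣_)
open import Data.Integer.Tactic.RingSolver using (solve-∀)
open import Data.Bool using (Bool; false; true)
import Data.Bool as Bool
open import Data.Fin as Fin using (Fin; zero; suc; opposite)
open import Data.Fin.Properties using (all?; injective⇒≤; opposite-involutive)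
open import Data.Vec using (Vec; []; _∷_; lookup)
open import Data.Vec.Relation.Unary.Unique.Propositional using (Unique)
open import Data.Vec.Relation.Unary.Unique.Propositional.Properties using (lookup-injective)
open import Data.Vec.Relation.Unary.All using ([]; _∷_)
open import Data.Vec.Relation.Unary.AllPairs using ([]; _∷_)
open import Data.List using (List; []; _∷_; _++_; map)
open import Data.List.Properties using (map-∘)
open import Data.List.Membership.Propositional using (_∈_; _∉_)
open import Data.List.Membership.Propositional.Properties using (∈-map⁺)
open import Data.List.Relation.Unary.Any using (any?)
open import Data.List.Relation.Binary.Pointwise using (Pointwise; []; _∷_; ++⁺; Pointwise-≡⇒≡)
open import Data.Product using (_×_; _,_; proj₁; proj₂)
open import Data.Product.Properties using (≡-dec)
open import Data.Sum using (inj₁; inj₂)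
open import Function using (_∘_; Injective)
open import Relation.Nullary using (¬_; Dec; yes; no; ¬?; contradiction)
open import Relation.Nullary.Decidable using (_→-dec_; from-yes; from-no)
open import Relation.Binary.Definitions using (DecidableEquality)
open import Relation.Binary.PropositionalEquality

∤1 : ∀ {n} → 2 ≤ n → ¬ n ℕ.∣ 1
∤1 2≤n n∣1 = ℕ.<⇒≢ 2≤n (sym (ℕ.∣1⇒≡1 n∣1))

∤prime : ∀ {n p} → Prime p → 2 ≤ n → n ≢ p → ¬ n ℕ.∣ p
∤prime p-prime 2≤n n≢p n∣p with prime⇒irreducible p-prime n∣p
... | inj₁ n≡1 = ℕ.<⇒≢ 2≤n (sym n≡1)
... | inj₂ n≡p = n≢p n≡p

Clique : (G : Graph) {k : ℕ} → (Fin k → V G) → Set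
Clique G f = ∀ i j → i ≢ j → f j ∈ nbrs G (f i)

clique? : (G : Graph) → DecidableEquality (V G) → {k : ℕ} (f : Fin k → V G) → Dec (Clique G f)
clique? G _≟_ f = all? λ i → all? λ j → ¬? (i Fin.≟ j) →-dec any? (f j ≟_) (nbrs G (f i))

clique-size≤order : ∀ {G ℓ k m} {f : Fin k → V G} →
                    Clique G f → Proper G ℓ → HasOrder G ℓ m → k ≤ m
clique-size≤order {f = f} clique proper (r , _ , covered , _) = injective⇒≤ index-injective
  where
  index : Fin _ → Fin _
  index i = proj₁ (covered (f i))

  index-injective : Injective _≡_ _≡_ index
  index-injective {i} {j} same-index with i Fin.≟ j
  ... | yes i≡j = i≡j
  ... | no i≢j = contradiction
    (trans (proj₂ (covered (f i))) (trans (cong r same-index) (sym (proj₂ (covered (f j))))))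
    (proper (f i) (f j) (clique i j i≢j))

record PerfectColouring (G : Graph) (k : ℕ) : Set where
  field
    colour                 : V G → Fin k
    nbrColours             : Fin k → List (Fin k)
    colour-nbrs            : ∀ v → map colour (nbrs G v) ≡ nbrColours (colour v)
    nbrColours-irreflexive : ∀ x → x ∉ nbrColours x

module _ {G : Graph} {k : ℕ} (P : PerfectColouring G k) where
  open PerfectColouring P

  colourSum : (Fin k → ℤ) → Fin k → ℤ
  colourSum L x = L x + sumℤ (map L (nbrColours x))

  closedSum-∘colour : (L : Fin k → ℤ) → ∀ v → closedSum G (L ∘ colour) v ≡ colourSum L (colour v)
  closedSum-∘colour L v = cong (λ xs → L (colour v) + sumℤ xs) (begin
    map (L ∘ colour) (nbrs G v)    ≡⟨ map-∘ (nbrs G v) ⟩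
    map L (map colour (nbrs G v))  ≡⟨ cong (map L) (colour-nbrs v) ⟩
    map L (nbrColours (colour v))  ∎)
    where open ≡-Reasoning

  proper-∘colour : {L : Fin k → ℤ} → Injective _≡_ _≡_ L → Proper G (L ∘ colour)
  proper-∘colour L-injective v w w∈nbrs same-label = nbrColours-irreflexive (colour v)
    (subst (_∈ nbrColours (colour v)) (sym (L-injective same-label))
      (subst (colour w ∈_) (colour-nbrs v) (∈-map⁺ colour w∈nbrs)))

  perfectColouring⇒ChiIs : {n : ℕ} {f : Fin k → V G} → Clique G f → (∀ i → colour (f i) ≡ i) →
                           (labels : Vec ℤ k) → Unique labels →
                           (∀ x → ¬ (+ n ∣ colourSum (lookup labels) x)) → ChiIs n G k
  perfectColouring⇒ChiIs {n} {f} clique rainbow labels distinct sums-nonzero =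
    (L ∘ colour , (proper-∘colour L-injective , nonzero) , order)
    , λ ℓ (proper , _) m ℓ-order → clique-size≤order clique proper ℓ-order
    where
    L : Fin k → ℤ
    L = lookup labels

    L-injective : Injective _≡_ _≡_ L
    L-injective {i} {j} = lookup-injective distinct i j

    nonzero : ClosedNonzeroMod n G (L ∘ colour)
    nonzero v = sums-nonzero (colour v) ∘ subst (+ n ∣_) (closedSum-∘colour L v)

    order : HasOrder G (L ∘ colour) k
    order = L , L-injective , (λ v → colour v , refl) , (λ i → f i , cong L (rainbow i))

private
  inc-sub : ∀ a b → (a + 1ℤ) - b ≡ (a - b) + 1ℤ
  inc-sub = solve-∀

  dec-sub : ∀ a b → (a - 1ℤ) - b ≡ (a - b) - 1ℤ
  dec-sub = solve-∀

  sub-inc : ∀ a b → a - (b + 1ℤ) ≡ (a - b) - 1ℤ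
  sub-inc = solve-∀

  sub-dec : ∀ a b → a - (b - 1ℤ) ≡ (a - b) + 1ℤ
  sub-dec = solve-∀

  inc-sub-dec : ∀ a b → (a + 1ℤ) - (b - 1ℤ) ≡ ((a - b) + 1ℤ) + 1ℤ
  inc-sub-dec = solve-∀

  dec-sub-inc : ∀ a b → (a - 1ℤ) - (b + 1ℤ) ≡ ((a - b) - 1ℤ) - 1ℤ
  dec-sub-inc = solve-∀

module Orbit {C : Set} (s p : C → C) (s∘p : ∀ x → s (p x) ≡ x) (p∘s : ∀ x → p (s x) ≡ x) (c₀ : C) where

  orbit : ℤ → C
  orbit (+ m)    = fold c₀ s m
  orbit -[1+ m ] = fold (p c₀) p m

  orbit-inc : ∀ a → orbit (inc a) ≡ s (orbit a)
  orbit-inc (+ m) rewrite ℕ.+-comm m 1 = refl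
  orbit-inc -[1+ zero ]  = sym (s∘p c₀)
  orbit-inc -[1+ suc m ] = sym (s∘p _)

  orbit-dec : ∀ a → orbit (dec a) ≡ p (orbit a)
  orbit-dec (+ zero)  = refl
  orbit-dec (+ suc m) = sym (p∘s _)
  orbit-dec -[1+ m ] rewrite ℕ.+-identityʳ m = refl

  difference : ℤ × ℤ → C
  difference (a , b) = orbit (a - b)

  squarePattern triangularPattern : C → List C
  squarePattern x = s x ∷ p x ∷ p x ∷ s x ∷ []
  triangularPattern x = squarePattern x ++ s (s x) ∷ p (p x) ∷ []

  private
    module Shifts (a b : ℤ) where
      d : ℤ
      d = a - b

      ↑ : ∀ {x} → x ≡ inc d → orbit x ≡ s (orbit d)
      ↑ refl = orbit-inc d

      ↓ : ∀ {x} → x ≡ dec d → orbit x ≡ p (orbit d)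
      ↓ refl = orbit-dec d

      ↑↑ : ∀ {x} → x ≡ inc (inc d) → orbit x ≡ s (s (orbit d))
      ↑↑ refl = trans (orbit-inc (inc d)) (cong s (orbit-inc d))

      ↓↓ : ∀ {x} → x ≡ dec (dec d) → orbit x ≡ p (p (orbit d))
      ↓↓ refl = trans (orbit-dec (dec d)) (cong p (orbit-dec d))

      square : Pointwise _≡_ (map difference (nbrs R₄ (a , b))) (squarePattern (orbit d))
      square = ↑ (inc-sub a b) ∷ ↓ (dec-sub a b) ∷ ↓ (sub-inc a b) ∷ ↑ (sub-dec a b) ∷ []

  difference-R₄-nbrs : ∀ v → map difference (nbrs R₄ v) ≡ squarePattern (difference v)
  difference-R₄-nbrs (a , b) = Pointwise-≡⇒≡ square
    where open Shifts a b

  difference-R₃-nbrs : ∀ v → map difference (nbrs R₃ v) ≡ triangularPattern (difference v)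
  difference-R₃-nbrs (a , b) = Pointwise-≡⇒≡ (++⁺ square (↑↑ (inc-sub-dec a b) ∷ ↓↓ (dec-sub-inc a b) ∷ []))
    where open Shifts a b

rotate rotate⁻¹ : Fin 3 → Fin 3
rotate zero             = suc zero
rotate (suc zero)       = suc (suc zero)
rotate (suc (suc zero)) = zero
rotate⁻¹ zero             = suc (suc zero)
rotate⁻¹ (suc zero)       = zero
rotate⁻¹ (suc (suc zero)) = suc zero

rotate∘rotate⁻¹ : ∀ x → rotate (rotate⁻¹ x) ≡ x
rotate∘rotate⁻¹ zero             = refl
rotate∘rotate⁻¹ (suc zero)       = refl
rotate∘rotate⁻¹ (suc (suc zero)) = refl

rotate⁻¹∘rotate : ∀ x → rotate⁻¹ (rotate x) ≡ x
rotate⁻¹∘rotate zero             = refl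
rotate⁻¹∘rotate (suc zero)       = refl
rotate⁻¹∘rotate (suc (suc zero)) = refl

module Mod₃ = Orbit rotate rotate⁻¹ rotate∘rotate⁻¹ rotate⁻¹∘rotate zero
module Mod₂ = Orbit {Fin 2} opposite opposite opposite-involutive opposite-involutive zero

irreflexive? : ∀ {k} (N : Fin k → List (Fin k)) → Dec (∀ x → x ∉ N x)
irreflexive? N = all? λ x → ¬? (any? (x Fin.≟_) (N x))

_≟²_ : DecidableEquality (ℤ × ℤ)
_≟²_ = ≡-dec ℤ._≟_ ℤ._≟_

R₃-colouring : PerfectColouring R₃ 3
R₃-colouring = record
  { colour                 = Mod₃.difference
  ; nbrColours             = Mod₃.triangularPattern
  ; colour-nbrs            = Mod₃.difference-R₃-nbrs
  ; nbrColours-irreflexive = from-yes (irreflexive? Mod₃.triangularPattern)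
  }

R₃-triangle : Fin 3 → ℤ × ℤ
R₃-triangle = lookup ((+ 0 , + 0) ∷ (+ 1 , + 0) ∷ (+ 1 , -[1+ 0 ]) ∷ [])

R₃-triangle-clique : Clique R₃ R₃-triangle
R₃-triangle-clique = from-yes (clique? R₃ _≟²_ R₃-triangle)

R₃-triangle-rainbow : ∀ i → Mod₃.difference (R₃-triangle i) ≡ i
R₃-triangle-rainbow = from-yes (all? λ i → Mod₃.difference (R₃-triangle i) Fin.≟ i)

-- A vertex sees each other colour three times, so its closed sum is
-- 3 (sum of all labels) − 2 (own label): 1, −1 and 7 for the labels 1, 2, −2.
χ-R₃ : ∀ n → 2 ≤ n → ChiIs n R₃ 3
χ-R₃ n 2≤n with n ℕ.≟ 7
... | yes refl = perfectColouring⇒ChiIs R₃-colouring R₃-triangle-clique R₃-triangle-rainbow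
  (+ 0 ∷ + 1 ∷ + 3 ∷ []) (((λ ()) ∷ (λ ()) ∷ []) ∷ ((λ ()) ∷ []) ∷ [] ∷ []) λ where
    zero             → from-no (7 ℕ.∣? 12)
    (suc zero)       → from-no (7 ℕ.∣? 10)
    (suc (suc zero)) → from-no (7 ℕ.∣? 6)
... | no n≢7 = perfectColouring⇒ChiIs R₃-colouring R₃-triangle-clique R₃-triangle-rainbow
  (+ 1 ∷ + 2 ∷ -[1+ 1 ] ∷ []) (((λ ()) ∷ (λ ()) ∷ []) ∷ ((λ ()) ∷ []) ∷ [] ∷ []) λ where
    zero             → ∤1 2≤n
    (suc zero)       → ∤1 2≤n
    (suc (suc zero)) → ∤prime (from-yes (prime? 7)) 2≤n n≢7

R₄-colouring : PerfectColouring R₄ 2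
R₄-colouring = record
  { colour                 = Mod₂.difference
  ; nbrColours             = Mod₂.squarePattern
  ; colour-nbrs            = Mod₂.difference-R₄-nbrs
  ; nbrColours-irreflexive = from-yes (irreflexive? Mod₂.squarePattern)
  }

R₄-edge : Fin 2 → ℤ × ℤ
R₄-edge = lookup ((+ 0 , + 0) ∷ (+ 1 , + 0) ∷ [])

R₄-edge-clique : Clique R₄ R₄-edge
R₄-edge-clique = from-yes (clique? R₄ _≟²_ R₄-edge)

R₄-edge-rainbow : ∀ i → Mod₂.difference (R₄-edge i) ≡ i
R₄-edge-rainbow = from-yes (all? λ i → Mod₂.difference (R₄-edge i) Fin.≟ i)

-- Closed sums ℓ + 4ℓ′: −1 and 11 for the labels 3, −1.
χ-R₄ : ∀ n → 2 ≤ n → ChiIs n R₄ 2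
χ-R₄ n 2≤n with n ℕ.≟ 11
... | yes refl = perfectColouring⇒ChiIs R₄-colouring R₄-edge-clique R₄-edge-rainbow
  (+ 1 ∷ + 0 ∷ []) (((λ ()) ∷ []) ∷ [] ∷ []) λ where
    zero       → from-no (11 ℕ.∣? 1)
    (suc zero) → from-no (11 ℕ.∣? 4)
... | no n≢11 = perfectColouring⇒ChiIs R₄-colouring R₄-edge-clique R₄-edge-rainbow
  (+ 3 ∷ -[1+ 0 ] ∷ []) (((λ ()) ∷ []) ∷ [] ∷ []) λ where
    zero       → ∤1 2≤n
    (suc zero) → ∤prime (from-yes (prime? 11)) 2≤n n≢11

side : ℤ × ℤ × Bool → Fin 2
side (_ , _ , false) = zero
side (_ , _ , true)  = suc zero

hexagonalPattern : Fin 2 → List (Fin 2)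
hexagonalPattern x = opposite x ∷ opposite x ∷ opposite x ∷ []

R₆-colouring : PerfectColouring R₆ 2
R₆-colouring = record
  { colour                 = side
  ; nbrColours             = hexagonalPattern
  ; colour-nbrs            = λ { (_ , _ , false) → refl ; (_ , _ , true) → refl }
  ; nbrColours-irreflexive = from-yes (irreflexive? hexagonalPattern)
  }

R₆-edge : Fin 2 → ℤ × ℤ × Bool
R₆-edge = lookup ((+ 0 , + 0 , false) ∷ (+ 0 , + 0 , true) ∷ [])

R₆-edge-clique : Clique R₆ R₆-edge
R₆-edge-clique = from-yes (clique? R₆ (≡-dec ℤ._≟_ (≡-dec ℤ._≟_ Bool._≟_)) R₆-edge)

R₆-edge-rainbow : ∀ i → side (R₆-edge i) ≡ i
R₆-edge-rainbow = from-yes (all? λ i → side (R₆-edge i) Fin.≟ i)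

-- Closed sums ℓ + 3ℓ′: 1 and 3 for the labels 1, 0.
χ-R₆ : ∀ n → 2 ≤ n → ChiIs n R₆ 2
χ-R₆ n 2≤n with n ℕ.≟ 3
... | yes refl = perfectColouring⇒ChiIs R₆-colouring R₆-edge-clique R₆-edge-rainbow
  (+ 1 ∷ + 2 ∷ []) (((λ ()) ∷ []) ∷ [] ∷ []) λ where
    zero       → from-no (3 ℕ.∣? 7)
    (suc zero) → from-no (3 ℕ.∣? 5)
... | no n≢3 = perfectColouring⇒ChiIs R₆-colouring R₆-edge-clique R₆-edge-rainbow
  (+ 1 ∷ + 0 ∷ []) (((λ ()) ∷ []) ∷ [] ∷ []) λ where
    zero       → ∤1 2≤n
    (suc zero) → ∤prime (from-yes (prime? 3)) 2≤n n≢3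

theorem4p8 : (n : ℕ) → 2 ≤ n → ChiIs n R₃ 3 × ChiIs n R₄ 2 × ChiIs n R₆ 2
theorem4p8 n 2≤n = χ-R₃ n 2≤n , χ-R₄ n 2≤n , χ-R₆ n 2≤n
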